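{- For every infinite set $D\subseteq\omega$ with $0\notin D$, there exist a bounded complexity measure $\psi$ and a nonempty closed class $A$ of decision tables from $\mathcal{M}_k^2$ such that $F^W_{\psi,A}(n)=F^\Theta_{\psi,A}(n)=H_D(n)$ for every $n\in\omega$.
   Context: Fix an integer $k\ge 2$; $\omega=\{0,1,2,\ldots\}$, $E_k=\{0,1,\ldots,k-1\}$, $E_2=\{0,1\}$. Let $P=\{f_i:i\in\omega\}$ be a set of attribute names ($f_i\ne f_j$ for $i\ne j$). $\mathcal{M}_k^2$ is the set of rectangular tables filled with numbers from $E_k$ whose columns are labeled with pairwise different attributes from $P$, whose rows are pairwise different, and in which each row is labeled with a decision from $E_2$. Tables without rows also belong to $\mathcal{M}_k^2$ and are all denoted $\Lambda$. Tables differing only by a permutation of rows are equal. $P(T)$ is the set of column attributes. $\mathcal{M}_k^2\mathcal{C}$ is the set of tables in which all rows have the same decision ($\Lambda$ included). $T(f_{i_1},\delta_1)\cdots(f_{i_m},\delta_m)$ is the table of rows of $T$ having values $\delta_1,\ldots,\delta_m$ in the columns labeled $f_{i_1},\ldots,f_{i_m}$. Operations: for $D\subseteq P(T)$, $I(D,T)$ deletes the columns labeled by $D$ and, in each group of rows coinciding on the remaining columns, keeps one row with the minimum decision; $I(P(T),T)=\Lambda$. For $\nu:E_k^{|P(T)|}\to E_2$, $J(\nu,T)$ replaces the decision of each row $\bar\delta$ by $\nu(\bar\delta)$. $[T]=\{J(\nu,I(D,T)):D\subseteq P(T),\nu:E_k^{|P(T)\setminus D|}\to E_2\}$; $[A]=\bigcup_{T\in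 A}[T]$; nonempty $A$ is a closed class if $[A]=A$. A test of $T$ is $D\subseteq P(T)$ such that any two rows with different decisions differ in a column labeled from $D$ (for $T\in\mathcal{M}_k^2\mathcal{C}$ every subset is a test). A $k$-decision tree: finite directed rooted tree with at least two nodes, root and its leaving edges unlabeled, terminal nodes labeled with decisions from $E_2$, other nodes labeled with attributes from $P$ whose leaving edges are labeled with numbers from $E_k$; $P(\Gamma)$ is the set of attributes at nodes. For a complete path $\tau=v_1,d_1,\ldots,v_m,d_m,v_{m+1}$ (root to terminal node), $F(\tau)$ is the empty word if $m=1$, else $f_{i_2}\cdots f_{i_m}$ where $v_j$ is labeled $f_{i_j}$; $T(\tau)=T$ if $m=1$, else $T(f_{i_2},\delta_2)\cdots(f_{i_m},\delta_m)$ with $d_j$ labeled $\delta_j$. For $T\ne\Lambda$, a deterministic decision tree for $T$: exactly one edge leaves the root, edges leaving any other nonterminal node have pairwise different labels, $P(\Gamma)\subseteq P(T)$, every row of $T$ lies in some $T(\tau)$, and for every complete path either $T(\tau)=\Lambda$ or all rows of $T(\tau)$ have the terminal node's decision. Let $B$ be the set of finite words over $P$ (with empty word $\lambda$). A complexity measure is $\psi:B\to\omega$ with $\psi(\alpha)=0$ iff $\alpha=\lambda$, invariant under permutation of letters, $\psi(\alpha_1)\le\psi(\alpha_1\alpha_2)\le\psi(\alpha_1)+\psi(\alpha_2)$; it is bounded if $\psi(\alpha)\ge|\alpha|$. For finite $D\subseteq P$: $\psi(\emptyset)=0$, $\psi(\{f_{i_1},\ldots,f_{i_m}\})=\psi(f_{i_1}\cdots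 f_{i_m})$. $\psi(\Gamma)=\max_\tau\psi(F(\tau))$ over complete paths. For $T\ne\Lambda$: $\psi^d(T)$ is the minimum of $\psi(\Gamma)$ over deterministic decision trees for $T$; $\Theta_\psi(T)$ the minimum of $\psi(D)$ over tests $D$; $W_\psi(T)=\psi(P(T))$; all are $0$ on $\Lambda$. $F^W_{\psi,A}(n)=\max\{\psi^d(T):T\in A,W_\psi(T)\le n\}$, $F^\Theta_{\psi,A}(n)=\max\{\psi^d(T):T\in A,\Theta_\psi(T)\le n\}$. For infinite $D=\{n_i:i\in\omega\}\subseteq\omega$ with $n_i<n_{i+1}$: $H_D(n)=0$ if $n<n_0$ and $H_D(n)=n_i$ if $n_i\le n<n_{i+1}$. -}

module Defs where

open import Data.Nat using (ℕ; zero; suc; _+_; _≤_; _<_; _≡ᵇ_)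
open import Data.Bool using (Bool; true; false; if_then_else_; not)
open import Data.Fin using (Fin) renaming (_≤_ to _≤ᶠ_)
open import Data.List using (List; []; _∷_; length; map; _++_)
open import Data.Bool.ListAction using (and)
open import Data.List.Membership.Propositional using (_∈_)
open import Data.List.Relation.Unary.All using (All)
open import Data.List.Relation.Unary.AllPairs using (AllPairs)
open import Data.List.Relation.Binary.Permutation.Propositional using (_↭_)
open import Data.Maybe using (Maybe; just; nothing)
open import Data.Product using (Σ; _×_; _,_; proj₁; ∃)
open import Relation.Binary.PropositionalEquality using (_≡_; _≢_)
open import Relation.Nullary using (¬_)

-- Attributes f_i are identified with their index i : ℕ.
-- Decisions from E_2 are Fin 2 (0 < 1 via Data.Fin._≤_).
-- Words over P are List ℕ.

IsComplexityMeasure : (List ℕ → ℕ) → Set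
IsComplexityMeasure ψ =
    (ψ [] ≡ 0)
  × (∀ α → ψ α ≡ 0 → α ≡ [])
  × (∀ α β → α ↭ β → ψ α ≡ ψ β)
  × (∀ α β → ψ α ≤ ψ (α ++ β))
  × (∀ α β → ψ (α ++ β) ≤ ψ α + ψ β)

IsBounded : (List ℕ → ℕ) → Set
IsBounded ψ = ∀ α → length α ≤ ψ α

-- Decision tables from M_k^2.
-- Columns: the set P(T), stored as a strictly increasing list of attribute
-- indices (so column sets have a canonical representation).
-- Rows: a partial map from value tuples (lists over E_k of length |P(T)|,
-- listed in the order of `cols`) to decisions; `just d` means the tuple is a
-- row of T with decision d. Thus rows are pairwise different and tables
-- differing by a permutation of rows coincide.

record Table (k : ℕ) : Set where
  field
    cols      : List ℕ
    colsInc   : AllPairs _<_ cols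
    rows      : List (Fin k) → Maybe (Fin 2)
    rowsLen   : ∀ r d → rows r ≡ just d → length r ≡ length cols
open Table public

module _ {k : ℕ} where

  IsΛ : Table k → Set
  IsΛ T = ∀ r → rows T r ≡ nothing

  select : {A : Set} → List Bool → List A → List A
  select (true ∷ s) (x ∷ xs) = x ∷ select s xs
  select (false ∷ s) (x ∷ xs) = select s xs
  select _ _ = []

  valAt : List ℕ → List (Fin k) → ℕ → Maybe (Fin k)
  valAt (c ∷ cs) (v ∷ vs) f = if c ≡ᵇ f then just v else valAt cs vs f
  valAt _ _ _ = nothing

  -- Operation I(D,T). A subset D ⊆ P(T) is given by a Bool list s of length
  -- |P(T)| (s marks the columns in D). IsI T s T' : T' = I(D,T).
  -- The remaining columns are `select (map not s)`.

  MinDec : Table k → List Bool → List (Fin k) → Maybe (Fin 2) → Set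
  MinDec T s r' nothing =
    ∀ r e → rows T r ≡ just e → select (map not s) r ≢ r'
  MinDec T s r' (just d) =
      (∃ λ r → rows T r ≡ just d × select (map not s) r ≡ r')
    × (∀ r e → rows T r ≡ just e → select (map not s) r ≡ r' → d ≤ᶠ e)

  IsI : Table k → List Bool → Table k → Set
  IsI T s T' =
      length s ≡ length (cols T)
    × (if and s
       then IsΛ T'
       else (cols T' ≡ select (map not s) (cols T)
             × (∀ r' → MinDec T s r' (rows T' r'))))

  -- Operation J(ν,T): T' = J(ν,T). ν is given on all tuples; only its values
  -- on tuples of length |P(T)| matter.
  IsJ : (List (Fin k) → Fin 2) → Table k → Table k → Set
  IsJ ν T T' =
      cols T' ≡ cols T
    × (∀ r → rows T' r ≡ Data.Maybe.map (λ _ → ν r) (rows T r))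

  InClosure : Table k → Table k → Set
  InClosure T T' =
    Σ (List Bool) λ s → Σ (List (Fin k) → Fin 2) λ ν → Σ (Table k) λ T'' →
      IsI T s T'' × IsJ ν T'' T'

  IsClosedClass : (Table k → Set) → Set
  IsClosedClass A =
      (∃ λ T → A T)
    × (∀ T T' → A T → InClosure T T' → A T')
    × (∀ T' → A T' → ∃ λ T → A T × InClosure T T')

  IsTest : Table k → List Bool → Set
  IsTest T s =
      length s ≡ length (cols T)
    × (∀ r₁ r₂ d₁ d₂ → rows T r₁ ≡ just d₁ → rows T r₂ ≡ just d₂ → d₁ ≢ d₂ →
         select s r₁ ≢ select s r₂)

  -- The (unlabeled) root has exactly one
  -- leaving edge; a DTree describes the node this edge enters. A node
  -- labeled by attribute f has at most one leaving edge per label δ ∈ E_k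
  -- (the child `c δ`, if present).

  data DTree : Set where
    leaf : Fin 2 → DTree
    node : ℕ → (Fin k → Maybe DTree) → DTree

  data WF : DTree → Set where
    leafW : ∀ {d} → WF (leaf d)
    nodeW : ∀ {f c} → (∃ λ δ → ∃ λ t → c δ ≡ just t) →
            (∀ δ t → c δ ≡ just t → WF t) → WF (node f c)

  data AttrsIn (cs : List ℕ) : DTree → Set where
    leafA : ∀ {d} → AttrsIn cs (leaf d)
    nodeA : ∀ {f c} → f ∈ cs → (∀ δ t → c δ ≡ just t → AttrsIn cs t) →
            AttrsIn cs (node f c)

  -- complete paths: the list of (attribute, edge label) pairs along the path
  -- and the decision at the terminal node. F(τ) = map proj₁ p.
  data Path : DTree → List (ℕ × Fin k) → Fin 2 → Set where
    leafP : ∀ {d} → Path (leaf d) [] d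
    nodeP : ∀ {f c δ t p d} → c δ ≡ just t → Path t p d →
            Path (node f c) ((f , δ) ∷ p) d

  RowOnPath : Table k → List (ℕ × Fin k) → List (Fin k) → Set
  RowOnPath T p r = All (λ fδ → valAt (cols T) r (proj₁ fδ) ≡ just (Data.Product.proj₂ fδ)) p

  IsDetTree : Table k → DTree → Set
  IsDetTree T Γ =
      WF Γ
    × AttrsIn (cols T) Γ
    × (∀ r d → rows T r ≡ just d → ∃ λ p → ∃ λ e → Path Γ p e × RowOnPath T p r)
    × (∀ p e → Path Γ p e → ∀ r d → rows T r ≡ just d → RowOnPath T p r → d ≡ e)

  PsiTree : (List ℕ → ℕ) → DTree → ℕ → Set
  PsiTree ψ Γ m =
      (∃ λ p → ∃ λ e → Path Γ p e × ψ (map proj₁ p) ≡ m)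
    × (∀ p e → Path Γ p e → ψ (map proj₁ p) ≤ m)

  PsiD : (List ℕ → ℕ) → Table k → ℕ → Set
  PsiD ψ T m =
      (IsΛ T → m ≡ 0)
    × (¬ IsΛ T →
         (∃ λ Γ → IsDetTree T Γ × PsiTree ψ Γ m)
       × (∀ Γ m' → IsDetTree T Γ → PsiTree ψ Γ m' → m ≤ m'))

  ThetaPsi : (List ℕ → ℕ) → Table k → ℕ → Set
  ThetaPsi ψ T m =
      (IsΛ T → m ≡ 0)
    × (¬ IsΛ T →
         (∃ λ s → IsTest T s × ψ (select s (cols T)) ≡ m)
       × (∀ s → IsTest T s → m ≤ ψ (select s (cols T))))

  WPsi : (List ℕ → ℕ) → Table k → ℕ → Set
  WPsi ψ T m = (IsΛ T → m ≡ 0) × (¬ IsΛ T → m ≡ ψ (cols T))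

  -- the sets whose maxima are F^W_{ψ,A}(n) and F^Θ_{ψ,A}(n)
  FWSet : (List ℕ → ℕ) → (Table k → Set) → ℕ → ℕ → Set
  FWSet ψ A n m = ∃ λ T → A T × (∃ λ w → WPsi ψ T w × w ≤ n) × PsiD ψ T m

  FThetaSet : (List ℕ → ℕ) → (Table k → Set) → ℕ → ℕ → Set
  FThetaSet ψ A n m = ∃ λ T → A T × (∃ λ w → ThetaPsi ψ T w × w ≤ n) × PsiD ψ T m

IsMaxOf : (ℕ → Set) → ℕ → Set
IsMaxOf P h = P h × (∀ m → P m → m ≤ h)

InfiniteSet : (ℕ → Bool) → Set
InfiniteSet D = ∀ n → ∃ λ m → n ≤ m × D m ≡ true

H : (ℕ → Bool) → ℕ → ℕ
H D zero = 0
H D (suc n) = if D (suc n) then suc n else H D n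

{-# OPTIONS --safe #-}
module Submission where

-- Fix d ∈ D and let ψ be additive, with weight i on f_i for i ∈ D and weight d on every other
-- attribute. As 0 ∉ D all weights are positive, so ψ is a bounded complexity measure, and the
-- cost of a single attribute always lies in D. Let A consist of the tables with one column and
-- the row-less tables; deleting the column of a one-column table yields Λ, so A is closed. For a
-- nonempty T ∈ A with column f, querying f is a decision tree, so ψ^d(T) ≤ ψ(f) = W_ψ(T), and a
-- test of T is either {f}, or ∅, in which case T has a single decision and ψ^d(T) = 0. Hence
-- F^W(n) and F^Θ(n) are 0 or at most an element of D below n, i.e. at most H_D(n). Conversely,
-- for h ∈ D the one-column table on f_h with rows 0 ↦ 0 and 1 ↦ 1 (here k ≥ 2 is needed) has
-- ψ^d = W_ψ = Θ_ψ = h, since every decision tree for it must query f_h.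

open import Defs
open import Data.Nat using (ℕ; zero; suc; _+_; _≤_; z≤n; s≤s; pred)
open import Data.Nat.Properties
  using (≤-refl; ≤-trans; m≤m+n; +-mono-≤; ≤-reflexive; +-identityʳ; m≤n⇒m<n∨m≡n; m≤n⇒m≤1+n;
         ≡⇒≡ᵇ)
open import Data.Nat.ListAction using (sum)
open import Data.Nat.ListAction.Properties using (sum-++; sum-↭)
open import Data.Bool using (Bool; true; false; if_then_else_)
open import Data.Bool.ListAction using (and)
open import Data.Bool.Properties using (T-≡)
open import Data.Fin using (Fin; zero; suc) renaming (_≤_ to _≤ᶠ_)
open import Data.Fin.Properties using () renaming (_≟_ to _≟ᶠ_; ≤-refl to ≤ᶠ-refl)
open import Data.List using (List; []; _∷_; length; map; _++_)
open import Data.List.Properties using (map-++; length-map)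
open import Data.List.Membership.Propositional using (_∈_)
open import Data.List.Relation.Binary.Permutation.Propositional.Properties using (map⁺)
open import Data.List.Relation.Unary.All using ([]; _∷_)
open import Data.List.Relation.Unary.AllPairs using ([]; _∷_)
open import Data.List.Relation.Unary.Any using (here)
open import Data.Maybe using (Maybe; just; nothing; fromMaybe)
import Data.Maybe as Maybe
open import Data.Maybe.Properties using (just-injective)
open import Data.Product using (Σ; _×_; _,_; proj₁; proj₂; ∃)
open import Data.Sum using (_⊎_; inj₁; inj₂)
open import Function using (case_of_)
open import Function.Bundles using (Equivalence)
open import Relation.Binary.PropositionalEquality using (_≡_; refl; sym; trans; cong; subst)
open import Relation.Nullary using (¬_; yes; no; contradiction)

private variable
  m m′ n x : ℕ
  D : ℕ → Bool

H≤n : ∀ D n → H D n ≤ n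
H≤n D zero = z≤n
H≤n D (suc n) with D (suc n)
... | true = ≤-refl
... | false = m≤n⇒m≤1+n (H≤n D n)

H-zero-or-member : ∀ D n → H D n ≡ 0 ⊎ D (H D n) ≡ true
H-zero-or-member D zero = inj₁ refl
H-zero-or-member D (suc n) with D (suc n) in D[1+n]
... | true = inj₂ D[1+n]
... | false = H-zero-or-member D n

H-maximal : D x ≡ true → x ≤ n → x ≤ H D n
H-maximal {n = zero} _ z≤n = z≤n
H-maximal {D} {n = suc n} D[x] x≤1+n with D (suc n) in D[1+n] | m≤n⇒m<n∨m≡n x≤1+n
... | true  | _ = x≤1+n
... | false | inj₁ (s≤s x≤n) = H-maximal D[x] x≤n
... | false | inj₂ refl = case trans (sym D[x]) D[1+n] of λ ()

weightSum : (ℕ → ℕ) → List ℕ → ℕ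
weightSum w α = sum (map w α)

module _ {w : ℕ → ℕ} where

  weightSum-++ : ∀ α β → weightSum w (α ++ β) ≡ weightSum w α + weightSum w β
  weightSum-++ α β = trans (cong sum (map-++ w α β)) (sum-++ (map w α) (map w β))

  weightSum-singleton : ∀ c → weightSum w (c ∷ []) ≡ w c
  weightSum-singleton c = +-identityʳ (w c)

  module _ (w-pos : ∀ i → 1 ≤ w i) where

    weightSum-isBounded : IsBounded (weightSum w)
    weightSum-isBounded [] = z≤n
    weightSum-isBounded (c ∷ α) = +-mono-≤ (w-pos c) (weightSum-isBounded α)

    weightSum-isComplexityMeasure : IsComplexityMeasure (weightSum w)
    weightSum-isComplexityMeasure =
      refl , zero⇒empty , (λ α β α↭β → sum-↭ (map⁺ w α↭β)) ,
      (λ α β → subst (weightSum w α ≤_) (sym (weightSum-++ α β)) (m≤m+n _ _)) ,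
      (λ α β → ≤-reflexive (weightSum-++ α β))
      where
      zero⇒empty : ∀ α → weightSum w α ≡ 0 → α ≡ []
      zero⇒empty [] _ = refl
      zero⇒empty (c ∷ α) sum≡0 =
        case subst (length (c ∷ α) ≤_) sum≡0 (weightSum-isBounded (c ∷ α)) of λ ()

weight : (ℕ → Bool) → ℕ → ℕ → ℕ
weight D d i = if D i then i else d

weight-member : ∀ {d} → D d ≡ true → ∀ i → D (weight D d i) ≡ true
weight-member {D} D[d] i with D i in D[i]
... | true = D[i]
... | false = D[d]

weight-self : ∀ d → D x ≡ true → weight D d x ≡ x
weight-self _ D[x] rewrite D[x] = refl

member-pos : D 0 ≡ false → D x ≡ true → 1 ≤ x
member-pos {x = zero} D[0] D[x] = case trans (sym D[0]) D[x] of λ ()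
member-pos {x = suc _} _ _ = s≤s z≤n

module WeightMeasure {D : ℕ → Bool} (D[0] : D 0 ≡ false) {d : ℕ} (D[d] : D d ≡ true) where

  ψ : List ℕ → ℕ
  ψ = weightSum (weight D d)

  weight-pos : ∀ i → 1 ≤ weight D d i
  weight-pos i = member-pos {D} D[0] (weight-member {D} D[d] i)

  ψ-isComplexityMeasure : IsComplexityMeasure ψ
  ψ-isComplexityMeasure = weightSum-isComplexityMeasure weight-pos

  ψ-isBounded : IsBounded ψ
  ψ-isBounded = weightSum-isBounded weight-pos

  ψ-singleton-member : ∀ c → D (ψ (c ∷ [])) ≡ true
  ψ-singleton-member c =
    subst (λ v → D v ≡ true) (sym (weightSum-singleton {weight D d} c)) (weight-member {D} D[d] c)

  ψ-singleton-self : ∀ h → D h ≡ true → ψ (h ∷ []) ≡ h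
  ψ-singleton-self h D[h] = trans (weightSum-singleton {weight D d} h) (weight-self {D} d D[h])

AtMostOneAttribute : List ℕ → Set
AtMostOneAttribute α = α ≡ [] ⊎ ∃ λ c → α ≡ c ∷ []

module _ {ψ : List ℕ → ℕ} (ψ[]≡0 : ψ [] ≡ 0)
         (ψ-singleton-member : ∀ c → D (ψ (c ∷ [])) ≡ true) where

  atMostOneAttribute-cost-≤H : ∀ {α} → AtMostOneAttribute α → ψ α ≤ n → ψ α ≤ H D n
  atMostOneAttribute-cost-≤H {n = n} (inj₁ refl) _ = subst (_≤ H D n) (sym ψ[]≡0) z≤n
  atMostOneAttribute-cost-≤H (inj₂ (c , refl)) = H-maximal (ψ-singleton-member c)

module _ {k : ℕ} where

  private variable
    ψ : List ℕ → ℕ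
    T T′ : Table k
    s : List Bool
    r : List (Fin k)
    d : Fin 2
    Γ : DTree {k}

  select-all : ∀ {A : Set} {xs : List A} (cs : List ℕ) → length xs ≡ length cs →
               select {k} (map (λ _ → true) cs) xs ≡ xs
  select-all {xs = []} [] _ = refl
  select-all {xs = _ ∷ _} (_ ∷ cs) len≡ = cong (_ ∷_) (select-all cs (cong pred len≡))

  select-[] : ∀ {A : Set} s → select {k} {A} s [] ≡ []
  select-[] [] = refl
  select-[] (true ∷ _) = refl
  select-[] (false ∷ _) = refl

  select-singleton : ∀ s c → AtMostOneAttribute (select {k} s (c ∷ []))
  select-singleton [] c = inj₁ refl
  select-singleton (true ∷ s) c = inj₂ (c , cong (c ∷_) (select-[] s))
  select-singleton (false ∷ s) c = inj₁ (select-[] s)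

  Λ : Table k
  Λ = record { cols = [] ; colsInc = [] ; rows = λ _ → nothing ; rowsLen = λ _ _ () }

  Λ-isΛ : IsΛ Λ
  Λ-isΛ _ = refl

  decisionsOf : Table k → List (Fin k) → Fin 2
  decisionsOf T r = fromMaybe zero (rows T r)

  J-decisionsOf : IsJ (decisionsOf T) T T
  J-decisionsOf {T} = refl , λ r → map-fromMaybe (rows T r)
    where
    map-fromMaybe : (e : Maybe (Fin 2)) → e ≡ Maybe.map (λ _ → fromMaybe zero e) e
    map-fromMaybe nothing = refl
    map-fromMaybe (just _) = refl

  J-isΛ : ∀ ν → IsJ ν T T′ → IsΛ T → IsΛ T′
  J-isΛ ν (_ , rows≡) T-isΛ r = trans (rows≡ r) (cong (Maybe.map (λ _ → ν r)) (T-isΛ r))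

  I-isΛ : IsΛ T → IsI T s T′ → IsΛ T′
  I-isΛ {T} {s} {T′} T-isΛ (_ , I-body) with and s
  ... | true = I-body
  ... | false = λ r′ → no-minimum (rows T′ r′) (proj₂ I-body r′)
    where
    no-minimum : ∀ {r′} (e : Maybe (Fin 2)) → MinDec T s r′ e → e ≡ nothing
    no-minimum nothing _ = refl
    no-minimum (just _) ((r , T[r] , _) , _) = case trans (sym (T-isΛ r)) T[r] of λ ()

  allColumns-isTest : IsTest T (map (λ _ → true) (cols T))
  allColumns-isTest {T} = length-map _ (cols T) , λ r₁ r₂ d₁ d₂ T[r₁] T[r₂] d₁≢d₂ sel≡ →
    d₁≢d₂ (just-injective
      (trans (sym T[r₁]) (trans (cong (rows T) (same-row T[r₁] T[r₂] sel≡)) T[r₂])))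
    where
    same-row : ∀ {r₁ r₂ d₁ d₂} → rows T r₁ ≡ just d₁ → rows T r₂ ≡ just d₂ →
               select {k} (map (λ _ → true) (cols T)) r₁ ≡ select {k} (map (λ _ → true) (cols T)) r₂ →
               r₁ ≡ r₂
    same-row {r₁} {r₂} {d₁} {d₂} T[r₁] T[r₂] sel≡ =
      trans (sym (select-all (cols T) (rowsLen T r₁ d₁ T[r₁])))
            (trans sel≡ (select-all (cols T) (rowsLen T r₂ d₂ T[r₂])))

  Λ-psiD : PsiD ψ Λ 0
  Λ-psiD = (λ _ → refl) , λ Λ-nonempty → contradiction Λ-isΛ Λ-nonempty

  Λ-W : WPsi ψ Λ 0
  Λ-W = (λ _ → refl) , λ Λ-nonempty → contradiction Λ-isΛ Λ-nonempty

  Λ-Θ : ThetaPsi ψ Λ 0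
  Λ-Θ = (λ _ → refl) , λ Λ-nonempty → contradiction Λ-isΛ Λ-nonempty

  psiD-suc⇒nonempty : PsiD ψ T (suc m) → ¬ IsΛ T
  psiD-suc⇒nonempty psiD T-isΛ = case proj₁ psiD T-isΛ of λ ()

  psiD-≤-tree : PsiD ψ T m → IsDetTree T Γ → PsiTree ψ Γ m′ → m ≤ m′
  psiD-≤-tree {m = zero} _ _ _ = z≤n
  psiD-≤-tree {ψ} {T} {suc _} psiD Γ-det Γ-cost =
    proj₂ (proj₂ psiD (psiD-suc⇒nonempty {ψ = ψ} {T = T} psiD)) _ _ Γ-det Γ-cost

  leaf-cost : ψ [] ≡ 0 → PsiTree {k} ψ (leaf d) 0
  leaf-cost ψ[]≡0 = ([] , _ , leafP , ψ[]≡0) , λ { _ _ leafP → ≤-reflexive ψ[]≡0 }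

  SingleDecision : Table k → Set
  SingleDecision T = ∀ r₁ r₂ d₁ d₂ → rows T r₁ ≡ just d₁ → rows T r₂ ≡ just d₂ → d₁ ≡ d₂

  leaf-isDetTree : SingleDecision T → rows T r ≡ just d → IsDetTree T (leaf d)
  leaf-isDetTree {r = r} single T[r] =
    leafW , leafA , (λ _ _ _ → [] , _ , leafP , []) ,
    λ { _ _ leafP r′ _ T[r′] [] → single r′ r _ _ T[r′] T[r] }

  psiD-singleDecision : ψ [] ≡ 0 → SingleDecision T → PsiD ψ T m → m ≡ 0
  psiD-singleDecision {m = zero} _ _ _ = refl
  psiD-singleDecision {ψ} {T} {suc _} ψ[]≡0 single psiD =
    contradiction T-isΛ (psiD-suc⇒nonempty {ψ = ψ} {T = T} psiD)
    where
    T-isΛ : IsΛ T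
    T-isΛ r with rows T r in T[r]
    ... | nothing = refl
    ... | just _ =
      case psiD-≤-tree {ψ = ψ} {T = T} psiD (leaf-isDetTree {T = T} single T[r]) (leaf-cost {ψ = ψ} ψ[]≡0)
      of λ ()

  emptyTest⇒singleDecision : IsTest T s → (∀ r → select {k} s r ≡ []) → SingleDecision T
  emptyTest⇒singleDecision (_ , separates) empty r₁ r₂ d₁ d₂ T[r₁] T[r₂] with d₁ ≟ᶠ d₂
  ... | yes d₁≡d₂ = d₁≡d₂
  ... | no d₁≢d₂ =
    contradiction (trans (empty r₁) (sym (empty r₂))) (separates r₁ r₂ d₁ d₂ T[r₁] T[r₂] d₁≢d₂)

SingleColumnOrΛ : ∀ {k} → Table k → Set
SingleColumnOrΛ T = IsΛ T ⊎ ∃ λ c → cols T ≡ c ∷ []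

J-singleColumnOrΛ : ∀ {k ν} {T″ T′ : Table k} → IsJ ν T″ T′ → SingleColumnOrΛ T″ → SingleColumnOrΛ T′
J-singleColumnOrΛ {ν = ν} {T″} {T′} J (inj₁ T″-isΛ) = inj₁ (J-isΛ {T = T″} {T′} ν J T″-isΛ)
J-singleColumnOrΛ J (inj₂ (c , cT″)) = inj₂ (c , trans (proj₁ J) cT″)

singleColumnOrΛ-nonempty : ∀ {k} {T : Table k} → SingleColumnOrΛ T → ¬ IsΛ T → ∃ λ c → cols T ≡ c ∷ []
singleColumnOrΛ-nonempty (inj₁ T-isΛ) T-nonempty = contradiction T-isΛ T-nonempty
singleColumnOrΛ-nonempty (inj₂ single) _ = single

valAt-own-column : ∀ {k} c (δ : Fin k) → valAt (c ∷ []) (δ ∷ []) c ≡ just δ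
valAt-own-column c δ rewrite Equivalence.to T-≡ (≡⇒≡ᵇ c c refl) = refl

module SingleColumn {k} {T : Table (suc k)} {c} (cT : cols T ≡ c ∷ []) where

  private variable
    ψ : List ℕ → ℕ
    r r′ : List (Fin (suc k))
    d e : Fin 2
    s : List Bool

  row-length : rows T r ≡ just d → length r ≡ 1
  row-length {r} {d} T[r] = trans (rowsLen T r d T[r]) (cong length cT)

  subset-length : length s ≡ length (cols T) → length s ≡ 1
  subset-length len≡ = trans len≡ (cong length cT)

  selected-atMostOneAttribute : ∀ s → AtMostOneAttribute (select {suc k} s (cols T))
  selected-atMostOneAttribute s =
    subst (λ cs → AtMostOneAttribute (select {suc k} s cs)) (sym cT) (select-singleton {k = suc k} s c)

  query : DTree
  query = node c (λ δ → just (leaf (decisionsOf T (δ ∷ []))))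

  query-isDetTree : IsDetTree T query
  query-isDetTree =
    nodeW (zero , _ , refl) (λ { _ _ refl → leafW }) ,
    nodeA (subst (c ∈_) (sym cT) (here refl)) (λ { _ _ refl → leafA }) ,
    (λ r _ T[r] → covering r (row-length T[r])) ,
    λ { _ _ (nodeP refl leafP) r _ T[r] (r[c]≡δ ∷ []) → correct r T[r] (row-length T[r]) r[c]≡δ }
    where
    valAt-row : ∀ δ → valAt (cols T) (δ ∷ []) c ≡ just δ
    valAt-row δ = subst (λ cs → valAt cs (δ ∷ []) c ≡ just δ) (sym cT) (valAt-own-column c δ)
    covering : ∀ r → length r ≡ 1 → ∃ λ p → ∃ λ e → Path query p e × RowOnPath T p r
    covering (δ ∷ []) _ = (c , δ) ∷ [] , _ , nodeP refl leafP , valAt-row δ ∷ []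
    correct : ∀ r {δ} → rows T r ≡ just d → length r ≡ 1 → valAt (cols T) r c ≡ just δ →
              d ≡ decisionsOf T (δ ∷ [])
    correct (x ∷ []) T[r] _ r[c]≡δ with just-injective (trans (sym (valAt-row x)) r[c]≡δ)
    ... | refl rewrite T[r] = refl

  query-cost : ∀ ψ → PsiTree ψ query (ψ (c ∷ []))
  query-cost ψ = ((c , zero) ∷ [] , _ , nodeP refl leafP , refl) , λ { _ _ (nodeP refl leafP) → ≤-refl }

  psiD-≤ : PsiD ψ T m → m ≤ ψ (c ∷ [])
  psiD-≤ {ψ} psiD = psiD-≤-tree {ψ = ψ} {T = T} psiD query-isDetTree (query-cost ψ)

  psiD-≤-test : ψ [] ≡ 0 → IsTest T s → PsiD ψ T m → m ≤ ψ (select {suc k} s (cols T))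
  psiD-≤-test {ψ} {s} {m} ψ[]≡0 test psiD = bound s (subset-length {s} (proj₁ test)) test
    where
    bound : ∀ s → length s ≡ 1 → IsTest T s → m ≤ ψ (select {suc k} s (cols T))
    bound (true ∷ []) _ _ =
      subst (λ cs → m ≤ ψ (select {suc k} (true ∷ []) cs)) (sym cT) (psiD-≤ {ψ = ψ} psiD)
    bound (false ∷ []) _ test = subst (_≤ _) (sym m≡0) z≤n
      where
      m≡0 : m ≡ 0
      m≡0 = psiD-singleDecision {ψ = ψ} {T = T} ψ[]≡0
              (emptyTest⇒singleDecision {T = T} {s = false ∷ []} test λ { [] → refl ; (_ ∷ _) → refl })
              psiD

  selected-row : rows T r ≡ just e → select {suc k} (true ∷ []) r ≡ r′ → rows T r′ ≡ just e
  selected-row {r} {e} T[r] sel≡r′ =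
    subst (λ r′ → rows T r′ ≡ just e)
          (trans (sym (select-all {k = suc k} (c ∷ []) (row-length T[r]))) sel≡r′) T[r]

  I-none : IsI T (false ∷ []) T
  I-none =
    sym (cong length cT) , sym (select-all {k = suc k} (c ∷ []) (cong length cT)) , λ r′ → minimal r′ _ refl
    where
    minimal : ∀ r′ e → rows T r′ ≡ e → MinDec T (false ∷ []) r′ e
    minimal r′ nothing T[r′] _ _ T[r] sel≡r′ = case trans (sym T[r′]) (selected-row T[r] sel≡r′) of λ ()
    minimal r′ (just d) T[r′] =
      (r′ , T[r′] , select-all {k = suc k} (c ∷ []) (row-length T[r′])) ,
      λ _ _ T[r] sel≡r′ →
        subst (d ≤ᶠ_) (just-injective (trans (sym T[r′]) (selected-row T[r] sel≡r′))) ≤ᶠ-refl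

  I-singleColumnOrΛ : ∀ {T″} → IsI T s T″ → SingleColumnOrΛ T″
  I-singleColumnOrΛ {s} {T″} I = result s (subset-length {s} (proj₁ I)) I
    where
    result : ∀ s → length s ≡ 1 → IsI T s T″ → SingleColumnOrΛ T″
    result (true ∷ []) _ (_ , T″-isΛ) = inj₁ T″-isΛ
    result (false ∷ []) _ (_ , cols≡ , _) = inj₂ (c , trans cols≡ (cong (select {suc k} (true ∷ [])) cT))

singleColumnOrΛ-isClosedClass : ∀ {k} → IsClosedClass {suc k} SingleColumnOrΛ
singleColumnOrΛ-isClosedClass {k} = (Λ , inj₁ Λ-isΛ) , closed , generated
  where
  closed : ∀ (T T′ : Table (suc k)) → SingleColumnOrΛ T → InClosure T T′ → SingleColumnOrΛ T′
  closed T T′ (inj₁ T-isΛ) (s , ν , T″ , I , J) =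
    inj₁ (J-isΛ {T = T″} {T′} ν J (I-isΛ {T = T} {s} {T″} T-isΛ I))
  closed T T′ (inj₂ (c , cT)) (s , ν , T″ , I , J) =
    J-singleColumnOrΛ {T″ = T″} {T′} J (SingleColumn.I-singleColumnOrΛ cT {T″ = T″} I)
  generated : ∀ (T′ : Table (suc k)) → SingleColumnOrΛ T′ → ∃ λ T → SingleColumnOrΛ T × InClosure T T′
  generated T′ (inj₁ T′-isΛ) =
    Λ , inj₁ Λ-isΛ , [] , decisionsOf T′ , T′ , (refl , T′-isΛ) , J-decisionsOf {T = T′}
  generated T′ (inj₂ (c , cT′)) =
    T′ , inj₂ (c , cT′) , false ∷ [] , decisionsOf T′ , T′ ,
    SingleColumn.I-none cT′ , J-decisionsOf {T = T′}

module _ {k : ℕ} {ψ : List ℕ → ℕ} (ψ[]≡0 : ψ [] ≡ 0)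
         (ψ-singleton-member : ∀ c → D (ψ (c ∷ [])) ≡ true) where

  FW-≤-H : FWSet ψ (SingleColumnOrΛ {suc k}) n m → m ≤ H D n
  FW-≤-H {m = zero} _ = z≤n
  FW-≤-H {n} {suc _} (T , T∈A , (w , W , w≤n) , psiD)
    with T-nonempty ← psiD-suc⇒nonempty {ψ = ψ} {T = T} psiD
    with c , cT ← singleColumnOrΛ-nonempty {T = T} T∈A T-nonempty =
    ≤-trans (SingleColumn.psiD-≤ {T = T} cT {ψ = ψ} psiD)
            (atMostOneAttribute-cost-≤H {ψ = ψ} ψ[]≡0 ψ-singleton-member (inj₂ (c , refl))
              (subst (_≤ n) w≡ψc w≤n))
    where
    w≡ψc : w ≡ ψ (c ∷ [])
    w≡ψc = trans (proj₂ W T-nonempty) (cong ψ cT)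

  FΘ-≤-H : FThetaSet ψ (SingleColumnOrΛ {suc k}) n m → m ≤ H D n
  FΘ-≤-H {m = zero} _ = z≤n
  FΘ-≤-H {n} {suc _} (T , T∈A , (w , Θ , w≤n) , psiD)
    with T-nonempty ← psiD-suc⇒nonempty {ψ = ψ} {T = T} psiD
    with c , cT ← singleColumnOrΛ-nonempty {T = T} T∈A T-nonempty
    with s , test , ψs≡w ← proj₁ (proj₂ Θ T-nonempty) =
    ≤-trans (SingleColumn.psiD-≤-test {T = T} cT {ψ = ψ} {s = s} ψ[]≡0 test psiD)
            (atMostOneAttribute-cost-≤H {ψ = ψ} ψ[]≡0 ψ-singleton-member
              (SingleColumn.selected-atMostOneAttribute {T = T} cT s) (subst (_≤ n) (sym ψs≡w) w≤n))

module BitTable {k : ℕ} where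

  bitRows : List (Fin (suc (suc k))) → Maybe (Fin 2)
  bitRows (zero ∷ []) = just zero
  bitRows (suc zero ∷ []) = just (suc zero)
  bitRows _ = nothing

  bitRows-length : ∀ r d → bitRows r ≡ just d → length r ≡ 1
  bitRows-length (zero ∷ []) _ _ = refl
  bitRows-length (suc zero ∷ []) _ _ = refl
  bitRows-length [] _ ()
  bitRows-length (zero ∷ _ ∷ _) _ ()
  bitRows-length (suc zero ∷ _ ∷ _) _ ()
  bitRows-length (suc (suc _) ∷ _) _ ()

  bitTable : ℕ → Table (suc (suc k))
  bitTable h = record { cols = h ∷ [] ; colsInc = [] ∷ [] ; rows = bitRows ; rowsLen = bitRows-length }

  module _ {ψ : List ℕ → ℕ} {h : ℕ} where

    bitTable-nonempty : ¬ IsΛ (bitTable h)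
    bitTable-nonempty bitTable-isΛ = case bitTable-isΛ (zero ∷ []) of λ ()

    bitTable-tree-cost : IsComplexityMeasure ψ → ∀ {Γ m} → IsDetTree (bitTable h) Γ → PsiTree ψ Γ m →
                         ψ (h ∷ []) ≤ m
    bitTable-tree-cost _ {leaf e} (_ , _ , _ , correct) _ =
      case trans (correct [] e leafP (zero ∷ []) zero refl [])
                 (sym (correct [] e leafP (suc zero ∷ []) (suc zero) refl [])) of λ ()
    bitTable-tree-cost (_ , _ , _ , ψ-mono , _) {node _ _} (_ , nodeA (here refl) _ , covers , _) (_ , cost-bound)
      with covers (zero ∷ []) zero refl
    ... | _ , _ , path@(nodeP {p = p} _ _) , _ = ≤-trans (ψ-mono (h ∷ []) (map proj₁ p)) (cost-bound _ _ path)

    bitTable-psiD : IsComplexityMeasure ψ → PsiD ψ (bitTable h) (ψ (h ∷ []))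
    bitTable-psiD ψ-measure =
      (λ bitTable-isΛ → contradiction bitTable-isΛ bitTable-nonempty) ,
      λ _ → (query , query-isDetTree , query-cost ψ) , λ _ _ → bitTable-tree-cost ψ-measure
      where open SingleColumn {T = bitTable h} refl

    bitTable-W : WPsi ψ (bitTable h) (ψ (h ∷ []))
    bitTable-W = (λ bitTable-isΛ → contradiction bitTable-isΛ bitTable-nonempty) , λ _ → refl

    bitTable-Θ : ThetaPsi ψ (bitTable h) (ψ (h ∷ []))
    bitTable-Θ =
      (λ bitTable-isΛ → contradiction bitTable-isΛ bitTable-nonempty) ,
      λ _ → (true ∷ [] , allColumns-isTest {T = bitTable h} , refl) , minimal
      where
      minimal : ∀ s → IsTest (bitTable h) s → ψ (h ∷ []) ≤ ψ (select {suc (suc k)} s (h ∷ []))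
      minimal (true ∷ []) _ = ≤-refl
      minimal (false ∷ []) (_ , separates) =
        contradiction refl (separates (zero ∷ []) (suc zero ∷ []) zero (suc zero) refl refl λ ())

open BitTable

module _ {k : ℕ} {ψ : List ℕ → ℕ} (ψ-measure : IsComplexityMeasure ψ)
         (ψ-singleton-self : ∀ h → D h ≡ true → ψ (h ∷ []) ≡ h) where

  H-attained : (X : Table (suc (suc k)) → ℕ → Set) → X Λ 0 → (∀ h → X (bitTable h) (ψ (h ∷ []))) →
               ∀ n → ∃ λ T → SingleColumnOrΛ T × (∃ λ w → X T w × w ≤ n) × PsiD ψ T (H D n)
  H-attained X X-Λ X-bitTable n with H-zero-or-member D n
  ... | inj₁ H≡0 rewrite H≡0 = Λ , inj₁ Λ-isΛ , (0 , X-Λ , z≤n) , Λ-psiD {ψ = ψ}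
  ... | inj₂ D[H] =
    bitTable (H D n) , inj₂ (_ , refl) ,
    (ψ (H D n ∷ []) , X-bitTable (H D n) , subst (_≤ n) (sym ψH≡H) (H≤n D n)) ,
    subst (PsiD ψ (bitTable (H D n))) ψH≡H (bitTable-psiD ψ-measure)
    where
    ψH≡H : ψ (H D n ∷ []) ≡ H D n
    ψH≡H = ψ-singleton-self (H D n) D[H]

theorem3 : (k : ℕ) → 2 ≤ k → (D : ℕ → Bool) → InfiniteSet D → D 0 ≡ false →
    Σ (List ℕ → ℕ) λ ψ → IsComplexityMeasure ψ × IsBounded ψ ×
      Σ (Table k → Set) λ A → IsClosedClass A ×
        ((n : ℕ) → IsMaxOf (FWSet ψ A n) (H D n) × IsMaxOf (FThetaSet ψ A n) (H D n))
theorem3 (suc (suc k)) (s≤s (s≤s _)) D D-infinite D[0] =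
  ψ , ψ-isComplexityMeasure , ψ-isBounded , SingleColumnOrΛ , singleColumnOrΛ-isClosedClass ,
  λ n → (H-attained ψ-isComplexityMeasure ψ-singleton-self (WPsi ψ) (Λ-W {ψ = ψ}) (λ h → bitTable-W {ψ = ψ} {h}) n ,
         λ _ → FW-≤-H {ψ = ψ} refl ψ-singleton-member) ,
        (H-attained ψ-isComplexityMeasure ψ-singleton-self (ThetaPsi ψ) (Λ-Θ {ψ = ψ}) (λ h → bitTable-Θ {ψ = ψ} {h}) n ,
         λ _ → FΘ-≤-H {ψ = ψ} refl ψ-singleton-member)
  where open WeightMeasure {D} D[0] (proj₂ (proj₂ (D-infinite 0)))
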